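{- Let $\succ$ be a complete strict social rule on $X$ with irreducible components $\mathcal T_1,\dots,\mathcal T_r$. If a social outcome $x\in\mathcal T_i$ belongs to the universal basin of attraction $\Psi(z)$ of a social outcome $z\in\mathcal T_j$, then $i\le j$.
   Context: Fix $n\ge1$ and positive integers $m_1,\dots,m_n$; social outcomes are $n$-tuples $x$ with $0\le x_i<m_i$, forming $X$. A complete strict social rule $\succ$ on $X$: for distinct $x,y$ exactly one of $x\succ y$, $y\succ x$ (not necessarily transitive); view it as a tournament with an arc $x\to y$ ($x$ dominates $y$) when $x\succ y$. The irreducible components are the maximal sub-tournaments in which every two nodes lie on a common directed cycle; they partition $X$ and are indexed $\mathcal T_1,\dots,\mathcal T_r$ so that for $i>j$ every node of $\mathcal T_i$ dominates every node of $\mathcal T_j$. An object is a nonempty $I\subseteq\{1,\dots,n\}$; an objects scheme is a finite set $A$ of objects with union $\{1,\dots,n\}$. $\Phi(x,I)=\{y: y\succ x,\ y_i=x_i\ \forall i\notin I\}$; $B(x,I)$ is the set of $y\in\Phi(x,I)$ with $y\succ w$ for all $w\in\Phi(x,I)\setminus\{y\}$. $x$ is a local optimum for $A$ if $\Phi(x,I)=\emptyset$ for all $I\in A$. A domination path through $A$ from $x$ to $y$ is a sequence $x=x_0,\dots,x_s=y$ ($s\ge 0$) with, for each $i\ge1$, some $I\in A$ with $x_i\in B(x_{i-1},I)$. $\Psi(z,A)$ is the set of $x$ such that $z$ is a local optimum for $A$ and a domination path through $A$ from $x$ to $z$ exists; $\Psi(z)=\bigcup_A\Psi(z,A)$ over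 all objects schemes $A$. -}

module Defs where

open import Level using (0ℓ)
open import Data.Nat using (ℕ; zero; suc; _≤_; _<_)
open import Data.Fin using (Fin; zero; suc)
open import Data.Fin.Subset using (Subset; _∈_; _∉_; Nonempty)
open import Data.Vec using (Vec; []; _∷_; lookup)
open import Data.Vec.Relation.Unary.All using (All; []; _∷_)
open import Data.List using (List)
import Data.List.Membership.Propositional as L
import Data.Sum
import Data.Fin
open import Data.Product using (Σ; ∃; _×_; _,_)
open import Relation.Binary.PropositionalEquality using (_≡_; _≢_)
open import Relation.Binary.Construct.Closure.ReflexiveTransitive using (Star)
open import Relation.Nullary using (¬_)

Outcome : {n : ℕ} → Vec ℕ n → Set
Outcome m = All Fin m

coord : {n : ℕ} {m : Vec ℕ n} → Outcome m → (i : Fin n) → Fin (lookup m i)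
coord (a ∷ x) zero    = a
coord (a ∷ x) (suc i) = coord x i

module _ {n : ℕ} {m : Vec ℕ n} where

  Rel : Set₁
  Rel = Outcome m → Outcome m → Set

  record IsCompleteStrict (_≻_ : Rel) : Set where
    field
      irrefl : ∀ x → ¬ (x ≻ x)
      total  : ∀ x y → x ≢ y → (x ≻ y) Data.Sum.⊎ (y ≻ x)
      asym   : ∀ x y → x ≻ y → ¬ (y ≻ x)

  -- "x and y lie on a common directed cycle (or coincide)": mutual reachability
  -- along arcs u → v (meaning u ≻ v)
  MutuallyReachable : Rel → Rel
  MutuallyReachable _≻_ x y = Star _≻_ x y × Star _≻_ y x

  -- An indexing of the irreducible components as T_1..T_r (here Fin r = 0..r-1):
  -- comp x is the index of the component containing x.
  record IrreducibleComponents (_≻_ : Rel) (r : ℕ) (comp : Outcome m → Fin r) : Set where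
    field
      surjective : ∀ (k : Fin r) → ∃ λ x → comp x ≡ k
      sameComp⇔  : ∀ x y → (comp x ≡ comp y → MutuallyReachable _≻_ x y)
                          × (MutuallyReachable _≻_ x y → comp x ≡ comp y)
      ordered    : ∀ x y → Data.Fin._<_ (comp y) (comp x) → x ≻ y

  Object : Subset n → Set
  Object I = Nonempty I

  record IsScheme (A : List (Subset n)) : Set where
    field
      objects : ∀ I → I L.∈ A → Object I
      covers  : ∀ (i : Fin n) → ∃ λ I → I L.∈ A × i ∈ I

  module _ (_≻_ : Rel) where

    Φ : Outcome m → Subset n → Outcome m → Set
    Φ x I y = (y ≻ x) × (∀ i → i ∉ I → coord y i ≡ coord x i)

    B : Outcome m → Subset n → Outcome m → Set
    B x I y = Φ x I y × (∀ w → Φ x I w → w ≢ y → y ≻ w)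

    LocalOptimum : List (Subset n) → Outcome m → Set
    LocalOptimum A x = ∀ I → I L.∈ A → ∀ y → ¬ Φ x I y

    data DomPath (A : List (Subset n)) : Outcome m → Outcome m → Set where
      done : ∀ {x} → DomPath A x x
      step : ∀ {x x₁ y} (I : Subset n) → I L.∈ A → B x I x₁ → DomPath A x₁ y → DomPath A x y

    ΨA : Outcome m → List (Subset n) → Outcome m → Set
    ΨA z A x = LocalOptimum A z × DomPath A x z

    -- universal basin of attraction: Ψ z x means x ∈ Ψ(z)
    Ψ : Outcome m → Outcome m → Set
    Ψ z x = Σ (List (Subset n)) λ A → IsScheme A × ΨA z A x

{-# OPTIONS --safe #-}
-- Every arc of a domination path points from an outcome to one that dominates it,
-- and an arc never descends in the component order: a node of a higher component
-- dominates every node of a lower one, so the reverse arc would contradict asymmetry.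
-- Hence the component index never decreases along a path from x to z.
module Submission where

open import Defs
open import Data.Nat using (ℕ; _≤_; _<_)
open import Data.Nat.Properties using (≤-refl; ≤-trans; ≮⇒≥)
open import Data.Fin using (Fin; toℕ)
open import Data.Vec using (Vec; lookup)
open import Data.Product using (_,_; proj₁)
open import Function using (flip)
open import Relation.Binary.Construct.Closure.ReflexiveTransitive using (Star; ε; _◅_)

module _ {n : ℕ} {m : Vec ℕ n} {_≻_ : Outcome m → Outcome m → Set} where

  domPath⇒star : ∀ {A x y} → DomPath _≻_ A x y → Star (flip _≻_) x y
  domPath⇒star done                          = ε
  domPath⇒star (step _ _ ((x₁≻x , _) , _) p) = x₁≻x ◅ domPath⇒star p

  module _ (cs : IsCompleteStrict _≻_) {r : ℕ} {comp : Outcome m → Fin r}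
           (ic : IrreducibleComponents _≻_ r comp) where

    comp-mono-≻ : ∀ {x y} → y ≻ x → toℕ (comp x) ≤ toℕ (comp y)
    comp-mono-≻ {x} {y} y≻x = ≮⇒≥ λ comp-y<comp-x →
      IsCompleteStrict.asym cs y x y≻x (IrreducibleComponents.ordered ic x y comp-y<comp-x)

    comp-mono-star : ∀ {x y} → Star (flip _≻_) x y → toℕ (comp x) ≤ toℕ (comp y)
    comp-mono-star ε         = ≤-refl
    comp-mono-star (y≻x ◅ p) = ≤-trans (comp-mono-≻ y≻x) (comp-mono-star p)

mainTheorem4 : (n : ℕ) → 1 ≤ n → (m : Vec ℕ n) → (∀ i → 0 < lookup m i)
    → (_≻_ : Outcome m → Outcome m → Set) → IsCompleteStrict _≻_
    → (r : ℕ) (comp : Outcome m → Fin r) → IrreducibleComponents _≻_ r comp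
    → (x z : Outcome m) → Ψ _≻_ z x → toℕ (comp x) ≤ toℕ (comp z)
mainTheorem4 _ _ _ _ _ cs _ _ ic _ _ (_ , _ , _ , path) =
  comp-mono-star cs ic (domPath⇒star path)
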